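{- For each $r\ge 1$, the Cartesian product $\mathrm{GP}(8,3)\,\square\, Q_r$ is a vertex-transitive normal bi-Cayley graph over $\mathrm{Q}_8\times N$, where $N\cong C_2^r$; that is, its automorphism group has a normal subgroup isomorphic to $\mathrm{Q}_8\times C_2^r$ acting semiregularly on the vertex set with two orbits.
   Context: $\mathrm{GP}(8,3)$ (the Möbius–Kantor graph) has vertex set $\{i,i' : i\in\mathbb{Z}_8\}$ and edges $\{i,i+1\}$, $\{i',(i+3)'\}$, $\{i,i'\}$ for $i\in\mathbb{Z}_8$. $Q_r$ is the $r$-dimensional hypercube, the graph on $\{0,1\}^r$ with tuples adjacent iff they differ in exactly one coordinate. $\mathrm{Q}_8$ is the quaternion group. The Cartesian product $X\square Y$ has vertex set $V(X)\times V(Y)$, with $(u,x)\sim(v,y)$ iff ($u=v$ and $x\sim y$) or ($x=y$ and $u\sim v$). A permutation group is semiregular if all point stabilizers are trivial. -}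

module Defs where

open import Data.Nat using (ℕ; _+_)
open import Data.Nat.DivMod using (_mod_)
open import Data.Fin using (Fin; toℕ)
open import Data.Bool using (Bool; true; false; _xor_)
open import Data.Vec using (Vec; lookup; zipWith; replicate)
open import Data.Product using (Σ; _×_; _,_; ∃)
open import Data.Sum using (_⊎_)
open import Relation.Binary.PropositionalEquality using (_≡_; _≢_)
open import Relation.Nullary using (¬_)

-- Simple graphs (adjacency given as a relation; symmetric by construction
-- for the graphs below)

record Graph : Set₁ where
  field
    V   : Set
    Adj : V → V → Set
open Graph public

record Aut (X : Graph) : Set where
  field
    fun     : V X → V X
    inv     : V X → V X
    fun-inv : ∀ v → fun (inv v) ≡ v
    inv-fun : ∀ v → inv (fun v) ≡ v
    pres    : ∀ u v → Adj X u v → Adj X (fun u) (fun v)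
    refl'   : ∀ u v → Adj X (fun u) (fun v) → Adj X u v
open Aut public

_⊕_ : Fin 8 → ℕ → Fin 8
i ⊕ k = (toℕ i + k) mod 8

data GPV : Set where
  out : Fin 8 → GPV
  inn : Fin 8 → GPV

data GPEdge : GPV → GPV → Set where
  rim   : ∀ i → GPEdge (out i) (out (i ⊕ 1))
  inner : ∀ i → GPEdge (inn i) (inn (i ⊕ 3))
  spoke : ∀ i → GPEdge (out i) (inn i)

GP83 : Graph
GP83 = record { V = GPV ; Adj = λ u v → GPEdge u v ⊎ GPEdge v u }

QAdj : ∀ {r} → Vec Bool r → Vec Bool r → Set
QAdj {r} x y = Σ (Fin r) λ i →
  (lookup x i ≢ lookup y i) × (∀ j → j ≢ i → lookup x j ≡ lookup y j)

Cube : ℕ → Graph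
Cube r = record { V = Vec Bool r ; Adj = QAdj }

_□_ : Graph → Graph → Graph
X □ Y = record
  { V   = V X × V Y
  ; Adj = λ { (u , x) (v , y) → (u ≡ v × Adj Y x y) ⊎ (x ≡ y × Adj X u v) }
  }

data QU : Set where
  𝟏 𝐢 𝐣 𝐤 : QU

-- product of units: (negative sign?, unit)
mulU : QU → QU → Bool × QU
mulU 𝟏 b = false , b
mulU a 𝟏 = false , a
mulU 𝐢 𝐢 = true , 𝟏
mulU 𝐣 𝐣 = true , 𝟏
mulU 𝐤 𝐤 = true , 𝟏
mulU 𝐢 𝐣 = false , 𝐤
mulU 𝐣 𝐤 = false , 𝐢
mulU 𝐤 𝐢 = false , 𝐣
mulU 𝐣 𝐢 = true , 𝐤
mulU 𝐤 𝐣 = true , 𝐢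
mulU 𝐢 𝐤 = true , 𝐣

-- (s , u) represents (-1)^s · u
Q8 : Set
Q8 = Bool × QU

_·Q_ : Q8 → Q8 → Q8
(s , a) ·Q (t , b) with mulU a b
... | (s' , c) = (s xor t xor s') , c

eQ : Q8
eQ = false , 𝟏

Q8×C2^ : ℕ → Set
Q8×C2^ r = Q8 × Vec Bool r

mulH : ∀ {r} → Q8×C2^ r → Q8×C2^ r → Q8×C2^ r
mulH (q , x) (q' , x') = (q ·Q q') , zipWith _xor_ x x'

eH : ∀ {r} → Q8×C2^ r
eH {r} = eQ , replicate r false

VertexTransitive : Graph → Set
VertexTransitive X = ∀ u v → Σ (Aut X) λ α → fun α u ≡ v

record NormalBiCayley (X : Graph) (G : Set) (_*_ : G → G → G) (e : G) : Set where
  field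
    φ         : G → Aut X
    hom       : ∀ g h v → fun (φ (g * h)) v ≡ fun (φ g) (fun (φ h) v)
    injective : ∀ g h → (∀ v → fun (φ g) v ≡ fun (φ h) v) → g ≡ h
    normal    : ∀ (α : Aut X) g → ∃ λ h →
                  ∀ v → fun α (fun (φ g) (inv α v)) ≡ fun (φ h) v
    semiregular : ∀ g v → fun (φ g) v ≡ v → g ≡ e
    v₀ v₁     : V X
    distinct-orbits : ¬ (∃ λ g → fun (φ g) v₀ ≡ v₁)
    covers    : ∀ v → (∃ λ g → fun (φ g) v₀ ≡ v) ⊎ (∃ λ g → fun (φ g) v₁ ≡ v)

-- The product X = GP(8,3) □ Q_r has two kinds of edges, and automorphisms cannot mix them: a
-- GP(8,3)-edge a–b extends to a path b–a–c lying on no 4-cycle (GP(8,3) has no 4-cycles and no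
-- leaves), while every path of length two in Q_r lies on a 4-cycle.  As both factors are connected,
-- every automorphism α of X therefore splits as α(u, y) = (σ u, τ y) with σ and τ monomorphisms of
-- the factors.  Q₈ acts semiregularly on GP(8,3) with two orbits (𝐢 as the rotation by 2, 𝐣 as
-- i ↦ 3i + 1 exchanging the two 8-cycles), and every σ normalises this action, which is checked by
-- running through all monomorphisms of GP(8,3).  Every monomorphism τ of Q_r is affine,
-- τ(y + z) = τ y + τ 0 + τ z, so α conjugates (q, y) ∈ Q₈ × C₂^r to (σ q σ⁻¹, τ y + τ 0).

module Submission where

open import Defs
open import Data.Bool using (Bool; true; false; _xor_; not; if_then_else_; T; _∧_) renaming (_≟_ to _≟ᵇ_)
open import Data.Bool.ListAction using (all)
open import Data.Bool.Properties
  using (T-∧; not-¬; ¬-not; xor-assoc; xor-comm; xor-identityˡ; xor-identityʳ; xor-same)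
open import Data.Empty using (⊥-elim)
open import Data.Fin using (Fin; zero; suc; toℕ; #_)
open import Data.Fin.Properties using () renaming (_≟_ to _≟ᶠ_)
open import Data.List using (List; []; _∷_; map; _++_; allFin; cartesianProduct; drop)
open import Data.List.Membership.Propositional using (_∈_; find; lose)
open import Data.List.Membership.Propositional.Properties
  using (∈-map⁺; ∈-++⁺ˡ; ∈-++⁺ʳ; ∈-allFin; ∈-cartesianProduct⁺)
import Data.List.Membership.DecPropositional as DecMembership
open import Data.List.Relation.Unary.All as All using (All; []; _∷_)
open import Data.List.Relation.Unary.All.Properties using (all⁺)
open import Data.List.Relation.Unary.Any as Any using (here; there)
open import Data.List.Relation.Unary.Enumerates.Setoid using (IsEnumeration)
open import Data.Maybe using (Maybe; just; nothing; fromMaybe; is-just)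
open import Data.Maybe.Properties using (just-injective)
open import Data.Nat using (ℕ; suc; _+_; _*_; _∸_; _≤_; _<_; _<?_)
open import Data.Nat.DivMod using (_mod_)
open import Data.Nat.Induction using (<-wellFounded)
open import Data.Product using (Σ; ∃; _×_; _,_; proj₁; proj₂)
open import Data.Product.Properties using (≡-dec)
open import Data.Sum as Sum using (_⊎_; inj₁; inj₂)
open import Data.Vec using (Vec; []; _∷_; lookup; zipWith; replicate)
open import Data.Vec.Properties using (lookup-zipWith; lookup-replicate; tabulate∘lookup; tabulate-cong)
open import Data.Vec.Relation.Binary.Pointwise.Inductive
  using (Pointwise-≡⇒≡; zipWith-assoc; zipWith-comm; zipWith-identityˡ; zipWith-identityʳ)
open import Function using (_∘_; id; case_of_)
open import Function.Bundles using (Equivalence)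
import Induction.WellFounded as WF
import Relation.Binary.Construct.On as On
open import Relation.Binary.Definitions using (DecidableEquality)
open import Relation.Binary.PropositionalEquality
open import Relation.Nullary using (¬_; Dec; yes; no; map′; from-yes; ¬?; _×-dec_; _⊎-dec_; _→-dec_)
open import Relation.Nullary.Decidable using (toWitness; ⌊_⌋)
open import Relation.Unary using (Decidable)

mkAut : (X : Graph) (f g : V X → V X) → (∀ v → f (g v) ≡ v) → (∀ v → g (f v) ≡ v) →
        (∀ {u v} → Adj X u v → Adj X (f u) (f v)) → (∀ {u v} → Adj X u v → Adj X (g u) (g v)) →
        Aut X
mkAut X f g f∘g g∘f f-pres g-pres = record
  { fun = f ; inv = g ; fun-inv = f∘g ; inv-fun = g∘f
  ; pres = λ _ _ → f-pres
  ; refl' = λ u v a → subst₂ (Adj X) (g∘f u) (g∘f v) (g-pres a)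
  }

module _ {X : Graph} where

  fun-injective : (α : Aut X) → ∀ {u v} → fun α u ≡ fun α v → u ≡ v
  fun-injective α {u} {v} eq = trans (sym (inv-fun α u)) (trans (cong (inv α) eq) (inv-fun α v))

  _⁻¹ᴬ : Aut X → Aut X
  α ⁻¹ᴬ = record
    { fun = inv α ; inv = fun α ; fun-inv = inv-fun α ; inv-fun = fun-inv α
    ; pres = λ u v a → refl' α _ _ (subst₂ (Adj X) (sym (fun-inv α u)) (sym (fun-inv α v)) a)
    ; refl' = λ u v a → subst₂ (Adj X) (fun-inv α u) (fun-inv α v) (pres α _ _ a)
    }

  _∘ᴬ_ : Aut X → Aut X → Aut X
  α ∘ᴬ β = record
    { fun = fun α ∘ fun β ; inv = inv β ∘ inv α
    ; fun-inv = λ v → trans (cong (fun α) (fun-inv β (inv α v))) (fun-inv α v)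
    ; inv-fun = λ v → trans (cong (inv β) (inv-fun α (fun β v))) (inv-fun β v)
    ; pres = λ u v a → pres α _ _ (pres β u v a)
    ; refl' = λ u v a → refl' β u v (refl' α _ _ a)
    }

_×ᴬ_ : {X Y : Graph} → Aut X → Aut Y → Aut (X □ Y)
β ×ᴬ γ = record
  { fun = λ (u , y) → fun β u , fun γ y
  ; inv = λ (u , y) → inv β u , inv γ y
  ; fun-inv = λ (u , y) → cong₂ _,_ (fun-inv β u) (fun-inv γ y)
  ; inv-fun = λ (u , y) → cong₂ _,_ (inv-fun β u) (inv-fun γ y)
  ; pres = λ { _ _ (inj₁ (u≡v , a)) → inj₁ (cong (fun β) u≡v , pres γ _ _ a)
             ; _ _ (inj₂ (x≡y , a)) → inj₂ (cong (fun γ) x≡y , pres β _ _ a) }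
  ; refl' = λ { _ _ (inj₁ (e , a)) → inj₁ (fun-injective β e , refl' γ _ _ a)
              ; _ _ (inj₂ (e , a)) → inj₂ (fun-injective γ e , refl' β _ _ a) }
  }

vertexTransitive-from : (X : Graph) (x₀ : V X) →
  (∀ v → Σ (Aut X) λ α → fun α x₀ ≡ v) → VertexTransitive X
vertexTransitive-from X x₀ reach u v with reach u | reach v
... | β , βx₀≡u | γ , γx₀≡v = γ ∘ᴬ (β ⁻¹ᴬ) , (begin
  fun γ (inv β u)          ≡⟨ cong (fun γ ∘ inv β) (sym βx₀≡u) ⟩
  fun γ (inv β (fun β x₀)) ≡⟨ cong (fun γ) (inv-fun β x₀) ⟩
  fun γ x₀                 ≡⟨ γx₀≡v ⟩
  v                        ∎)
  where open ≡-Reasoning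

□-vertexTransitive : {X Y : Graph} → VertexTransitive X → VertexTransitive Y → VertexTransitive (X □ Y)
□-vertexTransitive tX tY (u , x) (v , y) with tX u v | tY x y
... | β , βu≡v | γ , γx≡y = β ×ᴬ γ , cong₂ _,_ βu≡v γx≡y

record IsMonomorphism (X : Graph) (f : V X → V X) : Set where
  field
    injective : ∀ {u v} → f u ≡ f v → u ≡ v
    preserves : ∀ {u v} → Adj X u v → Adj X (f u) (f v)

Connected : Graph → Set₁
Connected X = ∀ {A : Set} (f : V X → A) → (∀ {u v} → Adj X u v → f u ≡ f v) → ∀ u v → f u ≡ f v

connected-by-parent : (X : Graph) (x₀ : V X) (parent : V X → V X) (depth : V X → ℕ) →
  (∀ v → v ≡ x₀ ⊎ (Adj X v (parent v) × depth (parent v) < depth v)) → Connected X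
connected-by-parent X x₀ parent depth toward f f-edge u v = trans (to-root u) (sym (to-root v))
  where
  to-root : ∀ v → f v ≡ f x₀
  to-root = WF.All.wfRec (On.wellFounded depth <-wellFounded) _ (λ v → f v ≡ f x₀) step
    where
    step : ∀ v → (∀ {w} → depth w < depth v → f w ≡ f x₀) → f v ≡ f x₀
    step v rec with toward v
    ... | inj₁ v≡x₀ = cong f v≡x₀
    ... | inj₂ (edge , closer) = trans (f-edge edge) (rec closer)

SquareFree : Graph → Set
SquareFree X = ∀ {u v w z} → Adj X u v → Adj X u w → v ≢ w → Adj X v z → Adj X w z → z ≡ u

LeafFree : Graph → Set
LeafFree X = ∀ {u v} → Adj X u v → ∃ λ w → Adj X u w × w ≢ v

EveryTwoPathInSquare : Graph → Set
EveryTwoPathInSquare Y =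
  ∀ {x y z} → Adj Y x y → Adj Y x z → y ≢ z → ∃ λ d → Adj Y y d × Adj Y z d × d ≢ x

module Enumerated {A : Set} {xs : List A} (enum : IsEnumeration (setoid A) xs) where

  all? : {P : A → Set} → Decidable P → Dec (∀ x → P x)
  all? P? = map′ (λ ps x → All.lookup ps (enum x)) (λ p → All.tabulate λ {x} _ → p x) (All.all? P? xs)

  any? : {P : A → Set} → Decidable P → Dec (∃ P)
  any? P? = map′ (λ p → let x , _ , px = find p in x , px) (λ (x , px) → lose (enum x) px) (Any.any? P? xs)

module MonomorphismSearch
  (X : Graph) (_≟_ : DecidableEquality (V X))
  {vertices : List (V X)} (enum : IsEnumeration (setoid (V X)) vertices)
  (adj? : ∀ u v → Dec (Adj X u v))
  (neighbours : V X → List (V X)) (adj⇒∈neighbours : ∀ {u v} → Adj X u v → v ∈ neighbours u)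
  {P : (V X → V X) → Set} (P? : Decidable P) (P-resp : ∀ {f g} → f ≗ g → P g → P f)
  where

  Assignment : Set
  Assignment = List (V X × V X)

  assigned : Assignment → V X → Maybe (V X)
  assigned [] v = nothing
  assigned ((u , s) ∷ as) v = if ⌊ u ≟ v ⌋ then just s else assigned as v

  extend : Assignment → V X → V X
  extend as v = fromMaybe v (assigned as v)

  Compatible : V X → V X → V X × V X → Set
  Compatible w t (u , s) = (Adj X w u → Adj X t s) × (t ≡ s → w ≡ u)

  compatible? : ∀ w t us → Dec (Compatible w t us)
  compatible? w t (u , s) = (adj? w u →-dec adj? t s) ×-dec (t ≟ s →-dec w ≟ u)

  -- Backtracking: each step (w , p) tries every neighbour t of the image of p as the image of w,
  -- discarding partial assignments that no monomorphism extends; complete ones must satisfy P.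
  search : List (V X × V X) → Assignment → Bool
  search [] as = all (is-just ∘ assigned as) vertices ∧ ⌊ P? (extend as) ⌋
  search ((w , p) ∷ order) as with assigned as p
  ... | nothing = false
  ... | just s  = ⌊ adj? p w ⌋ ∧ all (λ t → if ⌊ All.all? (compatible? w t) as ⌋
                                                  then search order ((w , t) ∷ as) else true) (neighbours s)

  if-yes : ∀ {A : Set} (a? : Dec A) → A → ∀ {b c} → T (if ⌊ a? ⌋ then b else c) → T b
  if-yes (yes _) _ t = t
  if-yes (no ¬a) a _ = ⊥-elim (¬a a)

  module _ {σ : V X → V X} (mono : IsMonomorphism X σ) where
    open IsMonomorphism mono

    Agrees : Assignment → Set
    Agrees = All λ (u , s) → σ u ≡ s

    assigned-agrees : ∀ {as v s} → Agrees as → assigned as v ≡ just s → σ v ≡ s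
    assigned-agrees {(u , s′) ∷ as} {v} (σu≡s′ ∷ agrees) eq with u ≟ v
    ... | yes refl = trans σu≡s′ (just-injective eq)
    ... | no _     = assigned-agrees agrees eq

    agrees-covering : ∀ {as} → Agrees as → T (all (is-just ∘ assigned as) vertices) → σ ≗ extend as
    agrees-covering {as} agrees covering v
      with assigned as v in eq | All.lookup (all⁺ _ vertices covering) (enum v)
    ... | just s | _ = assigned-agrees agrees eq

    σ-compatible : ∀ {as} w → Agrees as → All (Compatible w (σ w)) as
    σ-compatible w = All.map λ { refl → preserves , injective }

    search-sound : ∀ order as → Agrees as → T (search order as) → P σ
    search-sound [] as agrees ok with Equivalence.to (T-∧ {all (is-just ∘ assigned as) vertices}) ok
    ... | covering , P-extension = P-resp (agrees-covering agrees covering) (toWitness P-extension)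
    search-sound ((w , p) ∷ order) as agrees ok with assigned as p in eq
    ... | just s with Equivalence.to T-∧ ok
    ...   | p~w , branches = search-sound order ((w , σ w) ∷ as) (refl ∷ agrees) continue
      where
      σw∈ : σ w ∈ neighbours s
      σw∈ = subst (λ s → σ w ∈ neighbours s) (assigned-agrees agrees eq)
              (adj⇒∈neighbours (preserves (toWitness p~w)))
      continue : T (search order ((w , σ w) ∷ as))
      continue = if-yes (All.all? (compatible? w (σ w)) as) (σ-compatible w agrees)
                   (All.lookup (all⁺ _ (neighbours s) branches) σw∈)

  every-monomorphism : (v₀ : V X) (order : List (V X × V X)) →
    T (all (λ t → search order ((v₀ , t) ∷ [])) vertices) → ∀ {σ} → IsMonomorphism X σ → P σ
  every-monomorphism v₀ order ok {σ} mono =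
    search-sound mono order _ (refl ∷ []) (All.lookup (all⁺ _ vertices ok) (enum (σ v₀)))

module CartesianProduct (X Y : Graph)
  (X-squareFree : SquareFree X) (X-leafFree : LeafFree X)
  (Y-irreflexive : ∀ y → ¬ Adj Y y y) (Y-everyTwoPathInSquare : EveryTwoPathInSquare Y)
  where

  XEdge YEdge : V (X □ Y) → V (X □ Y) → Set
  XEdge (u , x) (v , y) = x ≡ y × Adj X u v
  YEdge (u , x) (v , y) = u ≡ v × Adj Y x y

  SquareFreeTurn : V (X □ Y) → V (X □ Y) → Set
  SquareFreeTurn a b = Σ (V (X □ Y)) λ c →
    Adj (X □ Y) a c × c ≢ b × (∀ {d} → Adj (X □ Y) b d → Adj (X □ Y) c d → d ≡ a)

  aut-preserves-turn : ∀ (α : Aut (X □ Y)) {a b} → SquareFreeTurn a b → SquareFreeTurn (fun α a) (fun α b)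
  aut-preserves-turn α {a} {b} (c , ac , c≢b , unique) =
    fun α c , pres α a c ac , c≢b ∘ fun-injective α , unique′
    where
    unique′ : ∀ {d} → Adj (X □ Y) (fun α b) d → Adj (X □ Y) (fun α c) d → d ≡ fun α a
    unique′ {d} bd cd = trans (sym (fun-inv α d)) (cong (fun α) (unique
      (refl' α b (inv α d) (subst (Adj (X □ Y) (fun α b)) (sym (fun-inv α d)) bd))
      (refl' α c (inv α d) (subst (Adj (X □ Y) (fun α c)) (sym (fun-inv α d)) cd))))

  XEdge-turn : ∀ {a b} → XEdge a b → SquareFreeTurn a b
  XEdge-turn {u , x} {v , .x} (refl , uv) with X-leafFree uv
  ... | w , uw , w≢v = (w , x) , inj₂ (refl , uw) , w≢v ∘ cong proj₁ , unique
    where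
    unique : ∀ {d} → Adj (X □ Y) (v , x) d → Adj (X □ Y) (w , x) d → d ≡ (u , x)
    unique (inj₁ (refl , _))  (inj₁ (w≡v , _))  = ⊥-elim (w≢v w≡v)
    unique (inj₁ (refl , xy)) (inj₂ (refl , _)) = ⊥-elim (Y-irreflexive _ xy)
    unique (inj₂ (refl , _))  (inj₁ (refl , xy)) = ⊥-elim (Y-irreflexive _ xy)
    unique (inj₂ (refl , vz)) (inj₂ (_ , wz))   = cong (_, x) (X-squareFree uv uw (w≢v ∘ sym) vz wz)

  YEdge-no-turn : ∀ {a b} → YEdge a b → ¬ SquareFreeTurn a b
  YEdge-no-turn {u , x} {.u , y} (refl , xy) ((w , z) , inj₂ (refl , uw) , _ , unique)
    with unique {w , y} (inj₂ (refl , uw)) (inj₁ (refl , xy))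
  ... | refl = Y-irreflexive _ xy
  YEdge-no-turn {u , x} {.u , y} (refl , xy) ((.u , z) , inj₁ (refl , xz) , c≢b , unique)
    with Y-everyTwoPathInSquare xy xz (c≢b ∘ sym ∘ cong (u ,_))
  ... | d , yd , zd , d≢x = d≢x (cong proj₂ (unique (inj₁ (refl , yd)) (inj₁ (refl , zd))))

  aut-preserves-XEdge : ∀ (α : Aut (X □ Y)) {a b} → XEdge a b → XEdge (fun α a) (fun α b)
  aut-preserves-XEdge α {a} {b} e with pres α a b (inj₂ e)
  ... | inj₁ image-YEdge = ⊥-elim (YEdge-no-turn image-YEdge (aut-preserves-turn α (XEdge-turn e)))
  ... | inj₂ image-XEdge = image-XEdge

  aut-preserves-YEdge : ∀ (α : Aut (X □ Y)) {a b} → YEdge a b → YEdge (fun α a) (fun α b)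
  aut-preserves-YEdge α {a} {b} e with pres α a b (inj₁ e)
  ... | inj₁ image-YEdge = image-YEdge
  ... | inj₂ image-XEdge = ⊥-elim (YEdge-no-turn e (subst₂ SquareFreeTurn (inv-fun α a) (inv-fun α b)
                              (aut-preserves-turn (α ⁻¹ᴬ) (XEdge-turn image-XEdge))))

  module Decomposition (X-connected : Connected X) (Y-connected : Connected Y) (x₀ : V X) (y₀ : V Y)
                       (α : Aut (X □ Y)) where

    σ : V X → V X
    σ u = proj₁ (fun α (u , y₀))

    τ : V Y → V Y
    τ y = proj₂ (fun α (x₀ , y))

    decomposition : ∀ u y → fun α (u , y) ≡ (σ u , τ y)
    decomposition u y = cong₂ _,_
      (Y-connected (λ y → proj₁ (fun α (u , y))) (λ xy → proj₁ (aut-preserves-YEdge α (refl , xy))) y y₀)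
      (X-connected (λ u → proj₂ (fun α (u , y))) (λ uv → proj₁ (aut-preserves-XEdge α (refl , uv))) u x₀)

    σ-monomorphism : IsMonomorphism X σ
    σ-monomorphism = record
      { injective = λ {u} {v} σu≡σv → cong proj₁ (fun-injective α (begin
          fun α (u , y₀)   ≡⟨ decomposition u y₀ ⟩
          (σ u , τ y₀)     ≡⟨ cong (_, τ y₀) σu≡σv ⟩
          (σ v , τ y₀)     ≡⟨ decomposition v y₀ ⟨
          fun α (v , y₀)   ∎))
      ; preserves = λ uv → proj₂ (aut-preserves-XEdge α (refl , uv))
      }
      where open ≡-Reasoning

    τ-monomorphism : IsMonomorphism Y τ
    τ-monomorphism = record
      { injective = λ {x} {y} τx≡τy → cong proj₂ (fun-injective α (begin
          fun α (x₀ , x)   ≡⟨ decomposition x₀ x ⟩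
          (σ x₀ , τ x)     ≡⟨ cong (σ x₀ ,_) τx≡τy ⟩
          (σ x₀ , τ y)     ≡⟨ decomposition x₀ y ⟨
          fun α (x₀ , y)   ∎))
      ; preserves = λ xy → proj₂ (aut-preserves-YEdge α (refl , xy))
      }
      where open ≡-Reasoning

module _ {r : ℕ} where

  infixr 6 _⊕ᵥ_
  _⊕ᵥ_ : Vec Bool r → Vec Bool r → Vec Bool r
  _⊕ᵥ_ = zipWith _xor_

  0ᵥ : Vec Bool r
  0ᵥ = replicate r false

  ⊕ᵥ-assoc : ∀ x y z → (x ⊕ᵥ y) ⊕ᵥ z ≡ x ⊕ᵥ (y ⊕ᵥ z)
  ⊕ᵥ-assoc x y z = Pointwise-≡⇒≡ (zipWith-assoc xor-assoc x y z)

  ⊕ᵥ-comm : ∀ x y → x ⊕ᵥ y ≡ y ⊕ᵥ x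
  ⊕ᵥ-comm x y = Pointwise-≡⇒≡ (zipWith-comm xor-comm x y)

  ⊕ᵥ-identityˡ : ∀ x → 0ᵥ ⊕ᵥ x ≡ x
  ⊕ᵥ-identityˡ x = Pointwise-≡⇒≡ (zipWith-identityˡ xor-identityˡ x)

  ⊕ᵥ-identityʳ : ∀ x → x ⊕ᵥ 0ᵥ ≡ x
  ⊕ᵥ-identityʳ x = Pointwise-≡⇒≡ (zipWith-identityʳ xor-identityʳ x)

  lookup-⊕ᵥ : ∀ x y k → lookup (x ⊕ᵥ y) k ≡ lookup x k xor lookup y k
  lookup-⊕ᵥ x y k = lookup-zipWith _xor_ k x y

  ≗-lookup⇒≡ : ∀ {x y : Vec Bool r} → (∀ k → lookup x k ≡ lookup y k) → x ≡ y
  ≗-lookup⇒≡ {x} {y} eq = trans (sym (tabulate∘lookup x)) (trans (tabulate-cong eq) (tabulate∘lookup y))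

  ⊕ᵥ-self : ∀ x → x ⊕ᵥ x ≡ 0ᵥ
  ⊕ᵥ-self x = ≗-lookup⇒≡ λ k →
    trans (lookup-⊕ᵥ x x k) (trans (xor-same (lookup x k)) (sym (lookup-replicate k false)))

  ⊕ᵥ-cancelˡ : ∀ y x → y ⊕ᵥ y ⊕ᵥ x ≡ x
  ⊕ᵥ-cancelˡ y x = begin
    y ⊕ᵥ y ⊕ᵥ x   ≡⟨ ⊕ᵥ-assoc y y x ⟨
    (y ⊕ᵥ y) ⊕ᵥ x ≡⟨ cong (_⊕ᵥ x) (⊕ᵥ-self y) ⟩
    0ᵥ ⊕ᵥ x       ≡⟨ ⊕ᵥ-identityˡ x ⟩
    x             ∎
    where open ≡-Reasoning

  ⊕ᵥ-cancelʳ : ∀ x y → (x ⊕ᵥ y) ⊕ᵥ y ≡ x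
  ⊕ᵥ-cancelʳ x y = trans (⊕ᵥ-assoc x y y) (trans (cong (x ⊕ᵥ_) (⊕ᵥ-self y)) (⊕ᵥ-identityʳ x))

  ⊕ᵥ-swap : ∀ x y z → x ⊕ᵥ y ⊕ᵥ z ≡ y ⊕ᵥ x ⊕ᵥ z
  ⊕ᵥ-swap x y z = trans (sym (⊕ᵥ-assoc x y z)) (trans (cong (_⊕ᵥ z) (⊕ᵥ-comm x y)) (⊕ᵥ-assoc y x z))

unit : ∀ {r} → Fin r → Vec Bool r
unit {suc r} zero = true ∷ replicate r false
unit (suc i) = false ∷ unit i

lookup-unit-≡ : ∀ {r} (i : Fin r) → lookup (unit i) i ≡ true
lookup-unit-≡ zero = refl
lookup-unit-≡ (suc i) = lookup-unit-≡ i

lookup-unit-≢ : ∀ {r} {i k : Fin r} → k ≢ i → lookup (unit i) k ≡ false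
lookup-unit-≢ {i = zero} {zero} k≢i = ⊥-elim (k≢i refl)
lookup-unit-≢ {i = zero} {suc k} _ = lookup-replicate k false
lookup-unit-≢ {i = suc i} {zero} _ = refl
lookup-unit-≢ {i = suc i} {suc k} k≢i = lookup-unit-≢ (k≢i ∘ cong suc)

module _ {r : ℕ} where

  lookup-flip-≡ : ∀ (i : Fin r) x → lookup (unit i ⊕ᵥ x) i ≡ not (lookup x i)
  lookup-flip-≡ i x = trans (lookup-⊕ᵥ (unit i) x i) (cong (_xor lookup x i) (lookup-unit-≡ i))

  lookup-flip-≢ : ∀ {i k : Fin r} x → k ≢ i → lookup (unit i ⊕ᵥ x) k ≡ lookup x k
  lookup-flip-≢ {i} {k} x k≢i = trans (lookup-⊕ᵥ (unit i) x k) (cong (_xor lookup x k) (lookup-unit-≢ k≢i))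

  flip-adjacent : ∀ (i : Fin r) x → QAdj x (unit i ⊕ᵥ x)
  flip-adjacent i x = i , (λ eq → not-¬ refl (trans eq (lookup-flip-≡ i x))) , λ k k≢i → sym (lookup-flip-≢ x k≢i)

  adjacent⇒flip : ∀ {x y : Vec Bool r} ((i , _) : QAdj x y) → y ≡ unit i ⊕ᵥ x
  adjacent⇒flip {x} {y} (i , xᵢ≢yᵢ , rest) = ≗-lookup⇒≡ λ k → case k ≟ᶠ i of λ where
    (yes refl) → trans (¬-not (xᵢ≢yᵢ ∘ sym)) (sym (lookup-flip-≡ i x))
    (no k≢i)   → trans (sym (rest k k≢i)) (sym (lookup-flip-≢ x k≢i))

  QAdj-irreflexive : ∀ (x : Vec Bool r) → ¬ QAdj x x
  QAdj-irreflexive _ (_ , xᵢ≢xᵢ , _) = xᵢ≢xᵢ refl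

  QAdj-sym : ∀ {x y : Vec Bool r} → QAdj x y → QAdj y x
  QAdj-sym (i , xᵢ≢yᵢ , rest) = i , xᵢ≢yᵢ ∘ sym , λ k k≢i → sym (rest k k≢i)

  flip-flip-≢ : ∀ {i j : Fin r} x → i ≢ j → unit j ⊕ᵥ unit i ⊕ᵥ x ≢ x
  flip-flip-≢ {i} {j} x i≢j eq = not-¬ refl (begin
    lookup x i                            ≡⟨ cong (λ y → lookup y i) eq ⟨
    lookup (unit j ⊕ᵥ unit i ⊕ᵥ x) i     ≡⟨ lookup-flip-≢ (unit i ⊕ᵥ x) i≢j ⟩
    lookup (unit i ⊕ᵥ x) i               ≡⟨ lookup-flip-≡ i x ⟩
    not (lookup x i)                      ∎)
    where open ≡-Reasoning

  flip-involutive : ∀ (i : Fin r) x → unit i ⊕ᵥ unit i ⊕ᵥ x ≡ x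
  flip-involutive i = ⊕ᵥ-cancelˡ (unit i)

  adjacent⇒difference : ∀ {x y : Vec Bool r} ((i , _) : QAdj x y) → x ⊕ᵥ y ≡ unit i
  adjacent⇒difference {x} adj@(i , _) = begin
    x ⊕ᵥ _               ≡⟨ cong (x ⊕ᵥ_) (adjacent⇒flip adj) ⟩
    x ⊕ᵥ unit i ⊕ᵥ x     ≡⟨ ⊕ᵥ-swap x (unit i) x ⟩
    unit i ⊕ᵥ x ⊕ᵥ x     ≡⟨ cong (unit i ⊕ᵥ_) (⊕ᵥ-self x) ⟩
    unit i ⊕ᵥ 0ᵥ         ≡⟨ ⊕ᵥ-identityʳ (unit i) ⟩
    unit i               ∎
    where open ≡-Reasoning

  translation-aut : Vec Bool r → Aut (Cube r)
  translation-aut y = mkAut (Cube r) (y ⊕ᵥ_) (y ⊕ᵥ_) (⊕ᵥ-cancelˡ y) (⊕ᵥ-cancelˡ y) translate translate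
    where
    translate : ∀ {x z} → QAdj x z → QAdj (y ⊕ᵥ x) (y ⊕ᵥ z)
    translate {x} adj@(i , _) = subst (QAdj (y ⊕ᵥ x))
      (trans (sym (⊕ᵥ-swap y (unit i) x)) (cong (y ⊕ᵥ_) (sym (adjacent⇒flip adj))))
      (flip-adjacent i (y ⊕ᵥ x))

  Cube-vertexTransitive : VertexTransitive (Cube r)
  Cube-vertexTransitive x z = translation-aut (z ⊕ᵥ x) , (begin
    (z ⊕ᵥ x) ⊕ᵥ x   ≡⟨ ⊕ᵥ-assoc z x x ⟩
    z ⊕ᵥ x ⊕ᵥ x     ≡⟨ cong (z ⊕ᵥ_) (⊕ᵥ-self x) ⟩
    z ⊕ᵥ 0ᵥ         ≡⟨ ⊕ᵥ-identityʳ z ⟩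
    z               ∎)
    where open ≡-Reasoning

  Cube-everyTwoPathInSquare : EveryTwoPathInSquare (Cube r)
  Cube-everyTwoPathInSquare {x} {y} {z} xy@(i , _) xz@(j , _) y≢z with i ≟ᶠ j
  ... | yes refl = ⊥-elim (y≢z (trans (adjacent⇒flip {x = x} {y = y} xy) (sym (adjacent⇒flip {x = x} {y = z} xz))))
  ... | no i≢j = unit j ⊕ᵥ y , flip-adjacent j y , z~d , d≢x
    where
    y≡ : y ≡ unit i ⊕ᵥ x
    y≡ = adjacent⇒flip xy
    z~d : QAdj z (unit j ⊕ᵥ y)
    z~d = subst₂ QAdj (sym (adjacent⇒flip {x = x} {y = z} xz))
      (trans (⊕ᵥ-swap (unit i) (unit j) x) (cong (unit j ⊕ᵥ_) (sym y≡))) (flip-adjacent i (unit j ⊕ᵥ x))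
    d≢x : unit j ⊕ᵥ y ≢ x
    d≢x = subst (λ y → unit j ⊕ᵥ y ≢ x) (sym y≡) (flip-flip-≢ x i≢j)

  square-parallel : ∀ {a b c d : Vec Bool r} → QAdj a b → QAdj b c → QAdj c d → QAdj d a →
                    a ≢ c → b ≢ d → a ⊕ᵥ b ≡ d ⊕ᵥ c
  square-parallel {a} {b} {c} {d} ab@(p , _) bc@(q , _) cd@(s , _) da@(t , _) a≢c b≢d =
    begin
      a ⊕ᵥ b   ≡⟨ adjacent⇒difference ab ⟩
      unit p   ≡⟨ cong unit p≡s ⟩
      unit s   ≡⟨ adjacent⇒difference cd ⟨
      c ⊕ᵥ d   ≡⟨ ⊕ᵥ-comm c d ⟩
      d ⊕ᵥ c   ∎
    where
    open ≡-Reasoning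
    b≡ : b ≡ unit p ⊕ᵥ a
    b≡ = adjacent⇒flip ab
    c≡ : c ≡ unit q ⊕ᵥ b
    c≡ = adjacent⇒flip bc
    d≡ : d ≡ unit s ⊕ᵥ c
    d≡ = adjacent⇒flip cd
    a≡ : a ≡ unit t ⊕ᵥ d
    a≡ = adjacent⇒flip da
    p≢q : p ≢ q
    p≢q refl = a≢c (begin
      a                        ≡⟨ flip-involutive p a ⟨
      unit p ⊕ᵥ unit p ⊕ᵥ a    ≡⟨ cong (unit p ⊕ᵥ_) b≡ ⟨
      unit p ⊕ᵥ b              ≡⟨ c≡ ⟨
      c                        ∎)
    -- a = eₜ + eₛ + e_q + eₚ + a; unless s = p, the p-th coordinate forces t = p, i.e. d = b.
    p≡s : p ≡ s
    p≡s with s ≟ᶠ p | t ≟ᶠ p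
    ... | yes s≡p | _ = sym s≡p
    ... | no s≢p | yes refl = ⊥-elim (b≢d (begin
      b                        ≡⟨ b≡ ⟩
      unit t ⊕ᵥ a              ≡⟨ cong (unit t ⊕ᵥ_) a≡ ⟩
      unit t ⊕ᵥ unit t ⊕ᵥ d    ≡⟨ flip-involutive t d ⟩
      d                        ∎))
    ... | no s≢p | no t≢p = ⊥-elim (not-¬ refl (begin
      lookup a p                 ≡⟨ cong (λ v → lookup v p) a≡ ⟩
      lookup (unit t ⊕ᵥ d) p     ≡⟨ lookup-flip-≢ d (t≢p ∘ sym) ⟩
      lookup d p                 ≡⟨ cong (λ v → lookup v p) d≡ ⟩
      lookup (unit s ⊕ᵥ c) p     ≡⟨ lookup-flip-≢ c (s≢p ∘ sym) ⟩
      lookup c p                 ≡⟨ cong (λ v → lookup v p) c≡ ⟩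
      lookup (unit q ⊕ᵥ b) p     ≡⟨ lookup-flip-≢ b p≢q ⟩
      lookup b p                 ≡⟨ cong (λ v → lookup v p) b≡ ⟩
      lookup (unit p ⊕ᵥ a) p     ≡⟨ lookup-flip-≡ p a ⟩
      not (lookup a p)           ∎))

flip-induction : ∀ {r} (P : Vec Bool r → Set) → P 0ᵥ → (∀ j y → P y → P (unit j ⊕ᵥ y)) → ∀ y → P y
flip-induction {0} P p₀ step [] = p₀
flip-induction {suc r} P p₀ step (false ∷ y) =
  flip-induction (P ∘ (false ∷_)) p₀ (λ j y → step (suc j) (false ∷ y)) y
flip-induction {suc r} P p₀ step (true ∷ y) =
  subst (P ∘ (true ∷_)) (⊕ᵥ-identityˡ y) (step zero (false ∷ y)
    (flip-induction (P ∘ (false ∷_)) p₀ (λ j y → step (suc j) (false ∷ y)) y))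

Cube-connected : ∀ {r} → Connected (Cube r)
Cube-connected {r} f f-edge x y = trans (to-0ᵥ x) (sym (to-0ᵥ y))
  where
  to-0ᵥ : ∀ x → f x ≡ f 0ᵥ
  to-0ᵥ = flip-induction (λ x → f x ≡ f 0ᵥ) refl λ j x fx≡f0 → trans (sym (f-edge (flip-adjacent j x))) fx≡f0

module _ {r : ℕ} {τ : Vec Bool r → Vec Bool r} (mono : IsMonomorphism (Cube r) τ) where
  open IsMonomorphism mono

  direction : Vec Bool r → Fin r → Vec Bool r
  direction x i = τ (unit i ⊕ᵥ x) ⊕ᵥ τ x

  -- Opposite sides of the image of the square x, eᵢx, eⱼeᵢx, eⱼx are parallel.
  direction-invariant : ∀ j x i → direction (unit j ⊕ᵥ x) i ≡ direction x i
  direction-invariant j x i with j ≟ᶠ i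
  ... | yes refl = trans (cong (λ v → τ v ⊕ᵥ τ (unit j ⊕ᵥ x)) (flip-involutive j x)) (⊕ᵥ-comm (τ x) _)
  ... | no j≢i = begin
    τ (eᵢ ⊕ᵥ eⱼ ⊕ᵥ x) ⊕ᵥ τ (eⱼ ⊕ᵥ x)   ≡⟨ cong (λ v → τ v ⊕ᵥ τ (eⱼ ⊕ᵥ x)) (⊕ᵥ-swap eᵢ eⱼ x) ⟩
    τ (eⱼ ⊕ᵥ eᵢ ⊕ᵥ x) ⊕ᵥ τ (eⱼ ⊕ᵥ x)   ≡⟨ ⊕ᵥ-comm _ _ ⟩
    τ (eⱼ ⊕ᵥ x) ⊕ᵥ τ (eⱼ ⊕ᵥ eᵢ ⊕ᵥ x)   ≡⟨ square-parallel ab bc cd da a≢c b≢d ⟨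
    τ x ⊕ᵥ τ (eᵢ ⊕ᵥ x)                 ≡⟨ ⊕ᵥ-comm _ _ ⟩
    τ (eᵢ ⊕ᵥ x) ⊕ᵥ τ x                 ∎
    where
    open ≡-Reasoning
    eᵢ eⱼ : Vec Bool r
    eᵢ = unit i
    eⱼ = unit j
    ab : QAdj (τ x) (τ (eᵢ ⊕ᵥ x))
    ab = preserves (flip-adjacent i x)
    bc : QAdj (τ (eᵢ ⊕ᵥ x)) (τ (eⱼ ⊕ᵥ eᵢ ⊕ᵥ x))
    bc = preserves (flip-adjacent j (eᵢ ⊕ᵥ x))
    cd : QAdj (τ (eⱼ ⊕ᵥ eᵢ ⊕ᵥ x)) (τ (eⱼ ⊕ᵥ x))
    cd = preserves (QAdj-sym {x = eⱼ ⊕ᵥ x} {y = eⱼ ⊕ᵥ eᵢ ⊕ᵥ x}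
      (subst (QAdj (eⱼ ⊕ᵥ x)) (⊕ᵥ-swap eᵢ eⱼ x) (flip-adjacent i (eⱼ ⊕ᵥ x))))
    da : QAdj (τ (eⱼ ⊕ᵥ x)) (τ x)
    da = preserves (QAdj-sym {x = x} {y = eⱼ ⊕ᵥ x} (flip-adjacent j x))
    a≢c : τ x ≢ τ (eⱼ ⊕ᵥ eᵢ ⊕ᵥ x)
    a≢c eq = flip-flip-≢ x (j≢i ∘ sym) (sym (injective eq))
    b≢d : τ (eᵢ ⊕ᵥ x) ≢ τ (eⱼ ⊕ᵥ x)
    b≢d eq = flip-flip-≢ x (j≢i ∘ sym) (trans (cong (eⱼ ⊕ᵥ_) (injective eq)) (flip-involutive j x))

  direction-constant : ∀ x i → direction x i ≡ direction 0ᵥ i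
  direction-constant x i = flip-induction (λ x → direction x i ≡ direction 0ᵥ i) refl
    (λ j x eq → trans (direction-invariant j x i) eq) x

  flip-image : ∀ j w → τ (unit j ⊕ᵥ w) ≡ direction 0ᵥ j ⊕ᵥ τ w
  flip-image j w = begin
    τ (unit j ⊕ᵥ w)                    ≡⟨ ⊕ᵥ-cancelʳ _ (τ w) ⟨
    (τ (unit j ⊕ᵥ w) ⊕ᵥ τ w) ⊕ᵥ τ w   ≡⟨ cong (_⊕ᵥ τ w) (direction-constant w j) ⟩
    direction 0ᵥ j ⊕ᵥ τ w              ∎
    where open ≡-Reasoning

  Cube-monomorphism-affine : ∀ y z → τ (y ⊕ᵥ z) ≡ (τ y ⊕ᵥ τ 0ᵥ) ⊕ᵥ τ z
  Cube-monomorphism-affine = flip-induction (λ y → ∀ z → τ (y ⊕ᵥ z) ≡ (τ y ⊕ᵥ τ 0ᵥ) ⊕ᵥ τ z) base step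
    where
    base : ∀ z → τ (0ᵥ ⊕ᵥ z) ≡ (τ 0ᵥ ⊕ᵥ τ 0ᵥ) ⊕ᵥ τ z
    base z = trans (cong τ (⊕ᵥ-identityˡ z)) (sym (trans (cong (_⊕ᵥ τ z) (⊕ᵥ-self (τ 0ᵥ))) (⊕ᵥ-identityˡ (τ z))))
    step : ∀ j y → (∀ z → τ (y ⊕ᵥ z) ≡ (τ y ⊕ᵥ τ 0ᵥ) ⊕ᵥ τ z) →
           ∀ z → τ ((unit j ⊕ᵥ y) ⊕ᵥ z) ≡ (τ (unit j ⊕ᵥ y) ⊕ᵥ τ 0ᵥ) ⊕ᵥ τ z
    step j y ih z = begin
      τ ((unit j ⊕ᵥ y) ⊕ᵥ z)          ≡⟨ cong τ (⊕ᵥ-assoc (unit j) y z) ⟩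
      τ (unit j ⊕ᵥ y ⊕ᵥ z)            ≡⟨ flip-image j (y ⊕ᵥ z) ⟩
      D ⊕ᵥ τ (y ⊕ᵥ z)                 ≡⟨ cong (D ⊕ᵥ_) (ih z) ⟩
      D ⊕ᵥ (τ y ⊕ᵥ τ 0ᵥ) ⊕ᵥ τ z        ≡⟨ ⊕ᵥ-assoc D _ (τ z) ⟨
      (D ⊕ᵥ τ y ⊕ᵥ τ 0ᵥ) ⊕ᵥ τ z        ≡⟨ cong (_⊕ᵥ τ z) (⊕ᵥ-assoc D (τ y) (τ 0ᵥ)) ⟨
      ((D ⊕ᵥ τ y) ⊕ᵥ τ 0ᵥ) ⊕ᵥ τ z      ≡⟨ cong (λ v → (v ⊕ᵥ τ 0ᵥ) ⊕ᵥ τ z) (flip-image j y) ⟨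
      (τ (unit j ⊕ᵥ y) ⊕ᵥ τ 0ᵥ) ⊕ᵥ τ z ∎
      where
      open ≡-Reasoning
      D : Vec Bool r
      D = direction 0ᵥ j

out-injective : ∀ {i j} → out i ≡ out j → i ≡ j
out-injective refl = refl

inn-injective : ∀ {i j} → inn i ≡ inn j → i ≡ j
inn-injective refl = refl

infix 4 _≟ᵛ_
_≟ᵛ_ : DecidableEquality GPV
out i ≟ᵛ out j = map′ (cong out) out-injective (i ≟ᶠ j)
inn i ≟ᵛ inn j = map′ (cong inn) inn-injective (i ≟ᶠ j)
out _ ≟ᵛ inn _ = no λ ()
inn _ ≟ᵛ out _ = no λ ()

GPVs : List GPV
GPVs = map out (allFin 8) ++ map inn (allFin 8)

GPV-enumeration : IsEnumeration (setoid GPV) GPVs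
GPV-enumeration (out i) = ∈-++⁺ˡ (∈-map⁺ out (∈-allFin i))
GPV-enumeration (inn i) = ∈-++⁺ʳ (map out (allFin 8)) (∈-map⁺ inn (∈-allFin i))

open Enumerated GPV-enumeration renaming (all? to allᵛ?; any? to anyᵛ?)

Fin8-enumeration : IsEnumeration (setoid (Fin 8)) (allFin 8)
Fin8-enumeration = ∈-allFin

open Enumerated Fin8-enumeration renaming (all? to allᶠ?)

-- Facts decided by exhaustive computation are kept opaque: unfolding one, e.g. when a proof
-- case-splits on it, would rerun the whole computation.
opaque
  ⊕-inverse : ∀ (k i : Fin 8) → (i ⊕ toℕ k) ⊕ (8 ∸ toℕ k) ≡ i
  ⊕-inverse = from-yes (allᶠ? λ k → allᶠ? λ i → (i ⊕ toℕ k) ⊕ (8 ∸ toℕ k) ≟ᶠ i)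

neighbours : GPV → List GPV
neighbours (out i) = out (i ⊕ 1) ∷ out (i ⊕ 7) ∷ inn i ∷ []
neighbours (inn i) = inn (i ⊕ 3) ∷ inn (i ⊕ 5) ∷ out i ∷ []

adj⇒∈neighbours : ∀ {u v} → Adj GP83 u v → v ∈ neighbours u
adj⇒∈neighbours (inj₁ (rim i))   = here refl
adj⇒∈neighbours (inj₁ (inner i)) = here refl
adj⇒∈neighbours (inj₁ (spoke i)) = there (there (here refl))
adj⇒∈neighbours (inj₂ (rim i))   = there (here (cong out (sym (⊕-inverse (# 1) i))))
adj⇒∈neighbours (inj₂ (inner i)) = there (here (cong inn (sym (⊕-inverse (# 3) i))))
adj⇒∈neighbours (inj₂ (spoke i)) = there (there (here refl))

∈neighbours⇒adj : ∀ u {v} → v ∈ neighbours u → Adj GP83 u v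
∈neighbours⇒adj (out i) (here refl)                = inj₁ (rim i)
∈neighbours⇒adj (out i) (there (here refl))        =
  inj₂ (subst (λ j → GPEdge (out (i ⊕ 7)) (out j)) (⊕-inverse (# 7) i) (rim (i ⊕ 7)))
∈neighbours⇒adj (out i) (there (there (here refl))) = inj₁ (spoke i)
∈neighbours⇒adj (inn i) (here refl)                = inj₁ (inner i)
∈neighbours⇒adj (inn i) (there (here refl))        =
  inj₂ (subst (λ j → GPEdge (inn (i ⊕ 5)) (inn j)) (⊕-inverse (# 5) i) (inner (i ⊕ 5)))
∈neighbours⇒adj (inn i) (there (there (here refl))) = inj₂ (spoke i)

open DecMembership _≟ᵛ_ using (_∈?_)

adj? : ∀ u v → Dec (Adj GP83 u v)
adj? u v = map′ (∈neighbours⇒adj u) adj⇒∈neighbours (v ∈? neighbours u)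

GP83-parent : GPV → GPV
GP83-parent (out i) = out (i ⊕ 7)
GP83-parent (inn i) = out i

GP83-depth : GPV → ℕ
GP83-depth (out i) = toℕ i
GP83-depth (inn i) = suc (toℕ i)

GP83-connected : Connected GP83
GP83-connected = connected-by-parent GP83 (out zero) GP83-parent GP83-depth (from-yes (allᵛ? λ v →
  (v ≟ᵛ out zero) ⊎-dec (adj? v (GP83-parent v) ×-dec GP83-depth (GP83-parent v) <? GP83-depth v)))

all-adjacent? : ∀ u {P : GPV → Set} → Decidable P → Dec (∀ {v} → Adj GP83 u v → P v)
all-adjacent? u P? = map′ (λ ps a → All.lookup ps (adj⇒∈neighbours a))
  (λ p → All.tabulate λ m → p (∈neighbours⇒adj u m)) (All.all? P? (neighbours u))

opaque
  GP83-squareFree : SquareFree GP83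
  GP83-squareFree {u} uv uw v≢w vz wz = from-yes (allᵛ? λ u → all-adjacent? u λ v →
    all-adjacent? u λ w → ¬? (v ≟ᵛ w) →-dec all-adjacent? v λ z → adj? w z →-dec z ≟ᵛ u)
    u uv uw v≢w vz wz

opaque
  GP83-leafFree : LeafFree GP83
  GP83-leafFree {u} uv =
    from-yes (allᵛ? λ u → all-adjacent? u λ v → anyᵛ? λ w → adj? u w ×-dec ¬? (w ≟ᵛ v)) u uv

QU-index : QU → Fin 4
QU-index 𝟏 = # 0
QU-index 𝐢 = # 1
QU-index 𝐣 = # 2
QU-index 𝐤 = # 3

QU-index-injective : ∀ {a b} → QU-index a ≡ QU-index b → a ≡ b
QU-index-injective {𝟏} {𝟏} refl = refl
QU-index-injective {𝐢} {𝐢} refl = refl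
QU-index-injective {𝐣} {𝐣} refl = refl
QU-index-injective {𝐤} {𝐤} refl = refl

infix 4 _≟Q_
_≟Q_ : DecidableEquality Q8
_≟Q_ = ≡-dec _≟ᵇ_ λ a b → map′ QU-index-injective (cong QU-index) (QU-index a ≟ᶠ QU-index b)

QU-enumeration : IsEnumeration (setoid QU) (𝟏 ∷ 𝐢 ∷ 𝐣 ∷ 𝐤 ∷ [])
QU-enumeration 𝟏 = here refl
QU-enumeration 𝐢 = there (here refl)
QU-enumeration 𝐣 = there (there (here refl))
QU-enumeration 𝐤 = there (there (there (here refl)))

Q8-enumeration : IsEnumeration (setoid Q8) (cartesianProduct (false ∷ true ∷ []) (𝟏 ∷ 𝐢 ∷ 𝐣 ∷ 𝐤 ∷ []))
Q8-enumeration (s , a) = ∈-cartesianProduct⁺ (Bool-enumeration s) (QU-enumeration a)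
  where
  Bool-enumeration : IsEnumeration (setoid Bool) (false ∷ true ∷ [])
  Bool-enumeration false = here refl
  Bool-enumeration true  = there (here refl)

open Enumerated Q8-enumeration renaming (all? to allᵠ?; any? to anyᵠ?)

rotate : ℕ → GPV → GPV
rotate k (out i) = out (i ⊕ k)
rotate k (inn i) = inn (i ⊕ k)

exchange : GPV → GPV
exchange (out i) = inn ((3 * toℕ i + 1) mod 8)
exchange (inn i) = out ((3 * toℕ i + 1) mod 8)

reflect : GPV → GPV
reflect (out i) = out ((1 + 7 * toℕ i) mod 8)
reflect (inn i) = inn ((1 + 7 * toℕ i) mod 8)

unit▷ : QU → GPV → GPV
unit▷ 𝟏 = id
unit▷ 𝐢 = rotate 2
unit▷ 𝐣 = exchange
unit▷ 𝐤 = rotate 2 ∘ exchange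

infixr 5 _▷_
_▷_ : Q8 → GPV → GPV
(false , a) ▷ v = unit▷ a v
(true  , a) ▷ v = rotate 4 (unit▷ a v)

_⁻¹Q : Q8 → Q8
(s , 𝟏) ⁻¹Q = s , 𝟏
(s , a) ⁻¹Q = not s , a

opaque
  ▷-hom : ∀ g h v → (g ·Q h) ▷ v ≡ g ▷ h ▷ v
  ▷-hom = from-yes (allᵠ? λ g → allᵠ? λ h → allᵛ? λ v → (g ·Q h) ▷ v ≟ᵛ g ▷ h ▷ v)

opaque
  ▷-inverseˡ : ∀ q v → q ⁻¹Q ▷ q ▷ v ≡ v
  ▷-inverseˡ = from-yes (allᵠ? λ q → allᵛ? λ v → q ⁻¹Q ▷ q ▷ v ≟ᵛ v)

opaque
  ▷-inverseʳ : ∀ q v → q ▷ q ⁻¹Q ▷ v ≡ v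
  ▷-inverseʳ = from-yes (allᵠ? λ q → allᵛ? λ v → q ▷ q ⁻¹Q ▷ v ≟ᵛ v)

opaque
  ▷-preserves : ∀ q {u v} → Adj GP83 u v → Adj GP83 (q ▷ u) (q ▷ v)
  ▷-preserves q {u} uv =
    from-yes (allᵠ? λ q → allᵛ? λ u → all-adjacent? u λ v → adj? (q ▷ u) (q ▷ v)) q u uv

opaque
  ▷-semiregular : ∀ q v → q ▷ v ≡ v → q ≡ eQ
  ▷-semiregular = from-yes (allᵠ? λ q → allᵛ? λ v → q ▷ v ≟ᵛ v →-dec q ≟Q eQ)

opaque
  ▷-faithful-at-out₀ : ∀ q q′ → q ▷ out zero ≡ q′ ▷ out zero → q ≡ q′
  ▷-faithful-at-out₀ =
    from-yes (allᵠ? λ q → allᵠ? λ q′ → q ▷ out zero ≟ᵛ q′ ▷ out zero →-dec q ≟Q q′)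

opaque
  ▷-orbits-distinct : ∀ q → q ▷ out zero ≢ out (# 1)
  ▷-orbits-distinct = from-yes (allᵠ? λ q → ¬? (q ▷ out zero ≟ᵛ out (# 1)))

opaque
  ▷-orbits-cover : ∀ v → (∃ λ q → q ▷ out zero ≡ v) ⊎ (∃ λ q → q ▷ out (# 1) ≡ v)
  ▷-orbits-cover = from-yes (allᵛ? λ v →
    anyᵠ? (λ q → q ▷ out zero ≟ᵛ v) ⊎-dec anyᵠ? (λ q → q ▷ out (# 1) ≟ᵛ v))

▷-aut : Q8 → Aut GP83
▷-aut q = mkAut GP83 (q ▷_) (q ⁻¹Q ▷_) (▷-inverseʳ q) (▷-inverseˡ q)
  (▷-preserves q) (▷-preserves (q ⁻¹Q))

reflect-aut : Aut GP83
reflect-aut = mkAut GP83 reflect reflect involutive involutive preserves preserves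
  where
  involutive : ∀ v → reflect (reflect v) ≡ v
  involutive = from-yes (allᵛ? λ v → reflect (reflect v) ≟ᵛ v)
  preserves : ∀ {u v} → Adj GP83 u v → Adj GP83 (reflect u) (reflect v)
  preserves {u} = from-yes (allᵛ? λ u → all-adjacent? u λ v → adj? (reflect u) (reflect v)) u

GP83-vertexTransitive : VertexTransitive GP83
GP83-vertexTransitive = vertexTransitive-from GP83 (out zero) reach
  where
  reach : ∀ v → Σ (Aut GP83) λ α → fun α (out zero) ≡ v
  reach v with ▷-orbits-cover v
  ... | inj₁ (q , q▷out₀≡v) = ▷-aut q , q▷out₀≡v
  ... | inj₂ (q , q▷out₁≡v) = ▷-aut q ∘ᴬ reflect-aut , q▷out₁≡v

Normalizes▷ : (GPV → GPV) → Set
Normalizes▷ σ = ∀ q → ∃ λ h → ∀ u → σ (q ▷ u) ≡ h ▷ σ u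

normalizes▷? : ∀ σ → Dec (Normalizes▷ σ)
normalizes▷? σ = allᵠ? λ q → anyᵠ? λ h → allᵛ? λ u → σ (q ▷ u) ≟ᵛ h ▷ σ u

normalizes▷-resp : ∀ {f g} → f ≗ g → Normalizes▷ g → Normalizes▷ f
normalizes▷-resp {f} {g} f≗g normal q with normal q
... | h , g-conj = h , λ u → trans (f≗g (q ▷ u)) (trans (g-conj u) (cong (h ▷_) (sym (f≗g u))))

open MonomorphismSearch GP83 _≟ᵛ_ GPV-enumeration adj? neighbours adj⇒∈neighbours
  normalizes▷? normalizes▷-resp using (every-monomorphism)

opaque
  GP83-monomorphism-normalizes▷ : ∀ {σ} → IsMonomorphism GP83 σ → Normalizes▷ σ
  GP83-monomorphism-normalizes▷ =
    every-monomorphism (out zero) (map (λ v → v , GP83-parent v) (drop 1 GPVs)) _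

module _ (r : ℕ) where
  open CartesianProduct GP83 (Cube r) GP83-squareFree GP83-leafFree
    QAdj-irreflexive Cube-everyTwoPathInSquare

  φ : Q8×C2^ r → Aut (GP83 □ Cube r)
  φ (q , y) = ▷-aut q ×ᴬ translation-aut y

  φ-hom : ∀ g h v → fun (φ (mulH g h)) v ≡ fun (φ g) (fun (φ h) v)
  φ-hom (q , y) (q′ , y′) (u , x) = cong₂ _,_ (▷-hom q q′ u) (⊕ᵥ-assoc y y′ x)

  φ-injective : ∀ g h → (∀ v → fun (φ g) v ≡ fun (φ h) v) → g ≡ h
  φ-injective (q , y) (q′ , y′) φg≗φh = cong₂ _,_ (▷-faithful-at-out₀ q q′ (cong proj₁ eq))
    (trans (sym (⊕ᵥ-identityʳ y)) (trans (cong proj₂ eq) (⊕ᵥ-identityʳ y′)))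
    where
    eq : (q ▷ out zero , y ⊕ᵥ 0ᵥ) ≡ (q′ ▷ out zero , y′ ⊕ᵥ 0ᵥ)
    eq = φg≗φh (out zero , 0ᵥ)

  φ-semiregular : ∀ g v → fun (φ g) v ≡ v → g ≡ eH
  φ-semiregular (q , y) (u , x) eq = cong₂ _,_ (▷-semiregular q u (cong proj₁ eq)) (begin
    y               ≡⟨ ⊕ᵥ-cancelʳ y x ⟨
    (y ⊕ᵥ x) ⊕ᵥ x   ≡⟨ cong (_⊕ᵥ x) (cong proj₂ eq) ⟩
    x ⊕ᵥ x          ≡⟨ ⊕ᵥ-self x ⟩
    0ᵥ              ∎)
    where open ≡-Reasoning

  φ-orbits-cover : ∀ v →
    (∃ λ g → fun (φ g) (out zero , 0ᵥ) ≡ v) ⊎ (∃ λ g → fun (φ g) (out (# 1) , 0ᵥ) ≡ v)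
  φ-orbits-cover (u , x) = Sum.map lift lift (▷-orbits-cover u)
    where
    lift : ∀ {w} → ∃ (λ q → q ▷ w ≡ u) → ∃ λ g → fun (φ g) (w , 0ᵥ) ≡ (u , x)
    lift (q , q▷w≡u) = (q , x) , cong₂ _,_ q▷w≡u (⊕ᵥ-identityʳ x)

  φ-normal : ∀ (α : Aut (GP83 □ Cube r)) g →
    ∃ λ h → ∀ v → fun α (fun (φ g) (inv α v)) ≡ fun (φ h) v
  φ-normal α (q , y) = (h , τ y ⊕ᵥ τ 0ᵥ) , conjugate
    where
    open Decomposition GP83-connected Cube-connected (out zero) 0ᵥ α
    h : Q8
    h = proj₁ (GP83-monomorphism-normalizes▷ σ-monomorphism q)
    σ-conj : ∀ u → σ (q ▷ u) ≡ h ▷ σ u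
    σ-conj = proj₂ (GP83-monomorphism-normalizes▷ σ-monomorphism q)
    conjugate : ∀ v → fun α (fun (φ (q , y)) (inv α v)) ≡ fun (φ (h , τ y ⊕ᵥ τ 0ᵥ)) v
    conjugate v = begin
      fun α (q ▷ u , y ⊕ᵥ x)             ≡⟨ decomposition (q ▷ u) (y ⊕ᵥ x) ⟩
      (σ (q ▷ u) , τ (y ⊕ᵥ x))           ≡⟨ cong₂ _,_ (σ-conj u) (Cube-monomorphism-affine τ-monomorphism y x) ⟩
      (h ▷ σ u , (τ y ⊕ᵥ τ 0ᵥ) ⊕ᵥ τ x)   ≡⟨ cong (fun (φ (h , τ y ⊕ᵥ τ 0ᵥ))) v≡ ⟨
      fun (φ (h , τ y ⊕ᵥ τ 0ᵥ)) v        ∎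
      where
      open ≡-Reasoning
      u : GPV
      u = proj₁ (inv α v)
      x : Vec Bool r
      x = proj₂ (inv α v)
      v≡ : v ≡ (σ u , τ x)
      v≡ = trans (sym (fun-inv α v)) (decomposition u x)

theorem3p3 : (r : ℕ) → 1 ≤ r →
    VertexTransitive (GP83 □ Cube r) × NormalBiCayley (GP83 □ Cube r) (Q8×C2^ r) mulH eH
theorem3p3 r _ = □-vertexTransitive GP83-vertexTransitive Cube-vertexTransitive , record
  { φ               = φ r
  ; hom             = φ-hom r
  ; injective       = φ-injective r
  ; normal          = φ-normal r
  ; semiregular     = φ-semiregular r
  ; v₀              = out zero , 0ᵥ
  ; v₁              = out (# 1) , 0ᵥ
  ; distinct-orbits = λ ((q , _) , eq) → ▷-orbits-distinct q (cong proj₁ eq)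
  ; covers          = φ-orbits-cover r
  }
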